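{- Let $q$ be a prime power, let $s\geq 4$ be an integer and $d=s^2-s+2$. Let $\mathcal{P}\subset \mathbb{F}_q[X_1,\dots,X_s,Y_1,\dots,Y_s]$ be the set of all polynomials $f(X,Y)$, where $X=(X_1,\dots,X_s)$ and $Y=(Y_1,\dots,Y_s)$, of degree at most $d$ in $X$ and degree at most $d$ in $Y$, and choose $f$ uniformly at random from $\mathcal{P}$. Let $r$ be a positive integer with $r,s\leq \min(\sqrt{q},d)$. Let $U\subset\mathbb{F}_q^s$ and $V\subset\mathbb{F}_q^s$ be sets of size $s$ and $r$ respectively. Then \[\Pr\bigl[f(u,v)=0\text{ for all }u\in U,\ v\in V\bigr]=q^{ -sr}.\]
   Context: "Degree at most $d$ in $X$" means every monomial of $f$ has total degree at most $d$ in the variables $X_1,\dots,X_s$; similarly for $Y$. -}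

module Defs where

open import Level using (Level; _⊔_)
open import Algebra.Bundles using (CommutativeRing)
open import Data.Nat as ℕ using (ℕ; _≤_; _^_)
import Data.Nat.Primality as Pr
open import Data.Fin using (Fin; zero; suc)
import Data.Fin.Properties as FinP
open import Data.Vec using (Vec; []; _∷_; lookup)
open import Data.List as L using (List; []; _∷_; _++_; concatMap; map; length; filter; allFin)
open import Data.Product using (_×_; _,_; Σ; ∃)
open import Relation.Nullary using (¬_; Dec; yes; no)
open import Relation.Unary using (Decidable)
open import Relation.Binary.PropositionalEquality using (_≡_)
import Relation.Binary.PropositionalEquality as ≡
open import Function.Bundles using (Inverse)

IsPrimePower : ℕ → Set
IsPrimePower q = Σ ℕ λ p → Σ ℕ λ k → Pr.Prime p × 1 ≤ k × q ≡ p ^ k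

record FiniteField (c ℓ : Level) (q : ℕ) : Set (Level.suc (c ⊔ ℓ)) where
  field
    cring   : CommutativeRing c ℓ
  open CommutativeRing cring public using (Carrier; _≈_; _+_; _*_; 0#; 1#; setoid)
  field
    _≟_     : (x y : Carrier) → Dec (x ≈ y)
    0≉1     : ¬ (0# ≈ 1#)
    inverse : ∀ x → ¬ (x ≈ 0#) → Σ Carrier λ y → x * y ≈ 1#
    enum    : Inverse (≡.setoid (Fin q)) setoid

-- all exponent vectors e ∈ ℕ^n with e₁ + … + eₙ ≤ d (each listed once)
expVecs : (n d : ℕ) → List (Vec ℕ n)
expVecs ℕ.zero    d = [] ∷ []
expVecs (ℕ.suc n) d = concatMap (λ k → map (k ∷_) (expVecs n (d ℕ.∸ k))) (L.upTo (ℕ.suc d))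

monomials : (s d : ℕ) → List (Vec ℕ s × Vec ℕ s)
monomials s d = L.cartesianProduct (expVecs s d) (expVecs s d)

allVecs : (q m : ℕ) → List (Vec (Fin q) m)
allVecs q ℕ.zero    = [] ∷ []
allVecs q (ℕ.suc m) = concatMap (λ x → map (x ∷_) (allVecs q m)) (allFin q)

module _ {c ℓ : Level} {q : ℕ} (F : FiniteField c ℓ q) where
  open FiniteField F

  pow : Carrier → ℕ → Carrier
  pow x ℕ.zero    = 1#
  pow x (ℕ.suc n) = x * pow x n

  monoVal : ∀ {n} → Vec ℕ n → (Fin n → Carrier) → Carrier
  monoVal []       x = 1#
  monoVal (e ∷ es) x = pow (x zero) e * monoVal es (λ i → x (suc i))

  -- evaluation of the polynomial Σ c_{(a,b)} X^a Y^b at (u,v), where the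
  -- coefficient list is aligned with the monomial list
  evalPoly : ∀ {s m} → List (Vec ℕ s × Vec ℕ s) → Vec (Fin q) m
           → (Fin s → Carrier) → (Fin s → Carrier) → Carrier
  evalPoly ((a , b) ∷ ms) (c ∷ cs) u v =
    (Inverse.to enum c * (monoVal a u * monoVal b v)) + evalPoly ms cs u v
  evalPoly _ _ u v = 0#

  -- coefficient vectors of polynomials in 𝒫 (deg_X ≤ d, deg_Y ≤ d)
  Coeffs : (s d : ℕ) → Set
  Coeffs s d = Vec (Fin q) (length (monomials s d))

  VanishesOn : ∀ {s r} (d : ℕ) → (Fin s → Fin s → Carrier) → (Fin r → Fin s → Carrier)
             → Coeffs s d → Set ℓ
  VanishesOn d U V cs = ∀ i j → evalPoly (monomials _ d) cs (U i) (V j) ≈ 0#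

  vanishes? : ∀ {s r} (d : ℕ) (U : Fin s → Fin s → Carrier) (V : Fin r → Fin s → Carrier)
            → Decidable (VanishesOn d U V)
  vanishes? d U V cs = FinP.all? (λ i → FinP.all? (λ j → evalPoly (monomials _ d) cs (U i) (V j) ≟ 0#))

  countVanishing : ∀ {s r} (d : ℕ) → (Fin s → Fin s → Carrier) → (Fin r → Fin s → Carrier) → ℕ
  countVanishing {s} d U V = length (filter (vanishes? d U V) (allVecs q (length (monomials s d))))

  Distinct : ∀ {n s} → (Fin n → Fin s → Carrier) → Set ℓ
  Distinct W = ∀ i j → ¬ (i ≡ j) → ¬ (∀ k → W i k ≈ W j k)

module Submission where

-- The polynomials f of degree ≤ d in X and ≤ d in Y are identified with
-- their coefficient vectors in (Fin q)^N, N = #monomials.  Each condition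
-- f(u, v) = 0 is an additive functional of the coefficients, and the s·r
-- conditions for (u, v) ∈ U × V are independent: for every point (U i, V j)
-- and every value t the polynomial t · δᵢ(X) · δⱼ(Y), where δᵢ and δⱼ are
-- Lagrange-type polynomials (products of separating linear forms, of degree
-- ≤ s resp. ≤ r, hence ≤ d), takes the value t at (U i, V j) and vanishes
-- at all other grid points.  A general counting lemma then shows that the
-- common kernel of M such functionals on (Fin q)^N has q^N / q^M elements,
-- which is the statement Pr[f vanishes on U × V] = q^(-sr).

open import Defs
open import Level using (Level; _⊔_)
open import Data.Nat as ℕ using (ℕ; zero; suc; _≤_; z≤n; s≤s; _∸_)
import Data.Nat.Properties as ℕP
open import Data.Bool using (true; false; if_then_else_)
open import Data.Fin using (Fin; zero; suc; combine; remQuot)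
import Data.Fin.Properties as FinP
open import Data.Fin.Permutation using (Permutation; permutation)
open import Data.Vec as Vec using (Vec; []; _∷_; replicate; updateAt)
open import Data.List using (List; []; _∷_; _++_; map; concatMap; length; filter; tabulate; allFin)
import Data.List.Properties as ListP
open import Data.List.Relation.Unary.All as All using (All; []; _∷_)
import Data.List.Relation.Unary.All.Properties as AllP
open import Data.List.Relation.Unary.Any using (Any; here; there)
open import Data.List.Membership.Propositional using (_∈_; lose)
open import Data.List.Membership.Propositional.Properties
  using (∈-allFin; ∈-map⁺; ∈-concatMap⁺; ∈-upTo⁺; ∈-cartesianProduct⁺)
open import Data.Product using (Σ-syntax; _×_; _,_; proj₁; proj₂)
open import Data.Empty using (⊥-elim)
open import Function using (_∘_)
open import Function.Bundles using (Inverse)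
open import Relation.Nullary using (¬_; Dec; yes; no; does)
open import Relation.Nullary.Decidable using (_×-dec_)
open import Relation.Unary using (Pred; Decidable)
open import Relation.Binary.PropositionalEquality as ≡ using (_≡_; _≢_)
open import Algebra.Bundles using (CommutativeRing)
open import Algebra.Properties.CommutativeMonoid.Sum ℕP.+-0-commutativeMonoid
  using (sum; sum-cong-≗; ∑-distrib-+; sum-permute; sum-replicate-zero)

count : ∀ {a p} {A : Set a} {P : Pred A p} → Decidable P → List A → ℕ
count P? xs = length (filter P? xs)

indicator : ∀ {p} {P : Set p} → Dec P → ℕ
indicator P? = if does P? then 1 else 0

module _ {a} {A : Set a} where

  count-∷ : ∀ {p} {P : Pred A p} (P? : Decidable P) x xs
          → count P? (x ∷ xs) ≡ indicator (P? x) ℕ.+ count P? xs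
  count-∷ P? x xs with does (P? x)
  ... | true  = ≡.refl
  ... | false = ≡.refl

  count-++ : ∀ {p} {P : Pred A p} (P? : Decidable P) xs ys
           → count P? (xs ++ ys) ≡ count P? xs ℕ.+ count P? ys
  count-++ P? xs ys = ≡.trans (≡.cong length (ListP.filter-++ P? xs ys)) (ListP.length-++ (filter P? xs))

  count-cong : ∀ {p r} {P : Pred A p} {Q : Pred A r} (P? : Decidable P) (Q? : Decidable Q)
             → (∀ x → P x → Q x) → (∀ x → Q x → P x) → ∀ xs → count P? xs ≡ count Q? xs
  count-cong P? Q? P⇒Q Q⇒P []       = ≡.refl
  count-cong P? Q? P⇒Q Q⇒P (x ∷ xs) with P? x | Q? x
  ... | yes _  | yes _  = ≡.cong suc (count-cong P? Q? P⇒Q Q⇒P xs)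
  ... | yes px | no ¬qx = ⊥-elim (¬qx (P⇒Q x px))
  ... | no ¬px | yes qx = ⊥-elim (¬px (Q⇒P x qx))
  ... | no _   | no _   = count-cong P? Q? P⇒Q Q⇒P xs

  count-map : ∀ {b p} {B : Set b} {P : Pred B p} (P? : Decidable P) (f : A → B) xs
            → count P? (map f xs) ≡ count (P? ∘ f) xs
  count-map P? f []       = ≡.refl
  count-map P? f (x ∷ xs) with does (P? (f x))
  ... | true  = ≡.cong suc (count-map P? f xs)
  ... | false = count-map P? f xs

sum-const : ∀ n c → sum {n} (λ _ → c) ≡ n ℕ.* c
sum-const zero    c = ≡.refl
sum-const (suc n) c = ≡.cong (c ℕ.+_) (sum-const n c)

sum-indicator : ∀ {n} (x : Fin n) → sum (λ y → indicator (x FinP.≟ y)) ≡ 1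
sum-indicator {suc n} zero    = ≡.cong suc (sum-replicate-zero n)
sum-indicator {suc n} (suc x) = ≡.trans (sum-cong-≗ {n} tail) (sum-indicator x)
  where
  tail : ∀ y → indicator (suc x FinP.≟ suc y) ≡ indicator (x FinP.≟ y)
  tail y with x FinP.≟ y
  ... | yes _ = ≡.refl
  ... | no  _ = ≡.refl

count-concatMap : ∀ {a b p} {A : Set a} {B : Set b} {P : Pred B p} (P? : Decidable P)
                  (g : A → List B) {n} (f : Fin n → A)
                → count P? (concatMap g (tabulate f)) ≡ sum (λ i → count P? (g (f i)))
count-concatMap P? g {zero}  f = ≡.refl
count-concatMap P? g {suc n} f =
  ≡.trans (count-++ P? (g (f zero)) (concatMap g (tabulate (f ∘ suc))))
        (≡.cong (count P? (g (f zero)) ℕ.+_) (count-concatMap P? g (f ∘ suc)))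

count-partition : ∀ {a p} {A : Set a} {n} (label : A → Fin n) {P : Pred A p} (P? : Decidable P) xs
  → count P? xs ≡ sum (λ y → count (λ x → P? x ×-dec (label x FinP.≟ y)) xs)
count-partition {n = n} label P? [] = ≡.sym (sum-replicate-zero n)
count-partition {n = n} label P? (x ∷ xs) = begin
  count P? (x ∷ xs)                                ≡⟨ count-∷ P? x xs ⟩
  indicator (P? x) ℕ.+ count P? xs                 ≡⟨ ≡.cong₂ ℕ._+_ (fibres-of-x (P? x)) (count-partition label P? xs) ⟩
  sum (λ y → indicator (Q? y x)) ℕ.+ sum (λ y → count (Q? y) xs) ≡⟨ ∑-distrib-+ (λ y → indicator (Q? y x)) _ ⟨
  sum (λ y → indicator (Q? y x) ℕ.+ count (Q? y) xs) ≡⟨ sum-cong-≗ (λ y → count-∷ (Q? y) x xs) ⟨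
  sum (λ y → count (Q? y) (x ∷ xs))                ∎
  where
  open ≡.≡-Reasoning
  Q? = λ y x → P? x ×-dec (label x FinP.≟ y)
  fibres-of-x : (d : Dec _) → indicator d ≡ sum (λ y → indicator (d ×-dec (label x FinP.≟ y)))
  fibres-of-x (yes _) = ≡.sym (sum-indicator (label x))
  fibres-of-x (no _)  = ≡.sym (sum-replicate-zero n)

-- Counting coefficient vectors in (Fin q)^N, where Fin q codes the elements
-- of the field F through its enumeration.
module VectorCounting {c ℓ : Level} {q : ℕ} (F : FiniteField c ℓ q) where
  open FiniteField F using (cring; _≟_)
  open CommutativeRing cring hiding (zero)
  open import Algebra.Properties.Ring ring using (//-rightDividesˡ; //-rightDividesʳ; +-identityˡ-unique)
  open Inverse (FiniteField.enum F) using (to; from; from-cong; strictlyInverseˡ; strictlyInverseʳ)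

  _⊞_ : Fin q → Fin q → Fin q
  x ⊞ y = from (to x + to y)

  _⊕_ : ∀ {n} → Vec (Fin q) n → Vec (Fin q) n → Vec (Fin q) n
  []      ⊕ []      = []
  (x ∷ a) ⊕ (y ∷ b) = (x ⊞ y) ∷ (a ⊕ b)

  shift : Fin q → Permutation q q
  shift y = permutation (_⊞ y) (λ x → from (to x - to y)) back forth
    where
    open import Relation.Binary.Reasoning.Setoid setoid
    back : ∀ x → from (to x - to y) ⊞ y ≡ x
    back x = ≡.trans (from-cong (begin
      to (from (to x - to y)) + to y ≈⟨ +-congʳ (strictlyInverseˡ _) ⟩
      (to x - to y) + to y           ≈⟨ //-rightDividesˡ (to y) (to x) ⟩
      to x                           ∎)) (strictlyInverseʳ x)
    forth : ∀ x → from (to (x ⊞ y) - to y) ≡ x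
    forth x = ≡.trans (from-cong (begin
      to (from (to x + to y)) - to y ≈⟨ +-congʳ (strictlyInverseˡ _) ⟩
      (to x + to y) - to y           ≈⟨ //-rightDividesʳ (to y) (to x) ⟩
      to x                           ∎)) (strictlyInverseʳ x)

  count-allVecs-suc : ∀ {p} m {P : Pred (Vec (Fin q) (suc m)) p} (P? : Decidable P)
    → count P? (allVecs q (suc m)) ≡ sum (λ x → count (P? ∘ (x ∷_)) (allVecs q m))
  count-allVecs-suc m P? =
    ≡.trans (count-concatMap P? (λ x → map (x ∷_) (allVecs q m)) (λ x → x))
          (sum-cong-≗ (λ x → count-map P? (x ∷_) (allVecs q m)))

  count-allVecs-all : ∀ {p} m {P : Pred (Vec (Fin q) m) p} (P? : Decidable P)
    → (∀ a → P a) → count P? (allVecs q m) ≡ q ℕ.^ m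
  count-allVecs-all zero    P? all with P? []
  ... | yes _  = ≡.refl
  ... | no ¬p = ⊥-elim (¬p (all []))
  count-allVecs-all (suc m) P? all = ≡.trans (count-allVecs-suc m P?)
    (≡.trans (sum-cong-≗ (λ x → count-allVecs-all m (P? ∘ (x ∷_)) (all ∘ (x ∷_)))) (sum-const q _))

  count-translate : ∀ {p} m {P : Pred (Vec (Fin q) m) p} (P? : Decidable P) (w : Vec (Fin q) m)
    → count P? (allVecs q m) ≡ count (λ a → P? (a ⊕ w)) (allVecs q m)
  count-translate zero    P? [] with P? []
  ... | yes _ = ≡.refl
  ... | no  _ = ≡.refl
  count-translate (suc m) P? (y ∷ w) = begin
    count P? (allVecs q (suc m))
      ≡⟨ count-allVecs-suc m P? ⟩
    sum (λ x → count (P? ∘ (x ∷_)) (allVecs q m))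
      ≡⟨ sum-permute _ (shift y) ⟩
    sum (λ x → count (P? ∘ ((x ⊞ y) ∷_)) (allVecs q m))
      ≡⟨ sum-cong-≗ (λ x → count-translate m (P? ∘ ((x ⊞ y) ∷_)) w) ⟩
    sum (λ x → count (λ a → P? ((x ⊞ y) ∷ (a ⊕ w))) (allVecs q m))
      ≡⟨ count-allVecs-suc m (λ a → P? (a ⊕ (y ∷ w))) ⟨
    count (λ a → P? (a ⊕ (y ∷ w))) (allVecs q (suc m)) ∎
    where open ≡.≡-Reasoning

  -- M additive functionals on coefficient vectors that are independent in
  -- the strongest sense: each admits, for every target value t, a vector on
  -- which it takes the value t while all the others vanish.
  record Independent (N M : ℕ) : Set (c ⊔ ℓ) where
    field
      L        : Fin M → Vec (Fin q) N → Carrier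
      additive : ∀ k a b → L k (a ⊕ b) ≈ L k a + L k b
      dual     : ∀ k t → Σ[ p ∈ Vec (Fin q) N ] (L k p ≈ t × (∀ j → j ≢ k → L j p ≈ 0#))

    Kernel : Pred (Vec (Fin q) N) ℓ
    Kernel a = ∀ k → L k a ≈ 0#

    kernel? : Decidable Kernel
    kernel? a = FinP.all? (λ k → L k a ≟ 0#)

  dropFirst : ∀ {N M} → Independent N (suc M) → Independent N M
  dropFirst I = record
    { L        = L ∘ suc
    ; additive = additive ∘ suc
    ; dual     = λ k t → let (p , Lp≈t , others) = dual (suc k) t
                         in p , Lp≈t , λ j j≢k → others (suc j) (j≢k ∘ FinP.suc-injective)
    }
    where open Independent I

  -- Each fibre of the first functional over the common kernel of the others
  -- is a translate of the full kernel: translate by a vector on which the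
  -- first functional takes the prescribed value and the others vanish.
  fibre-count : ∀ {N M} (I : Independent N (suc M)) (y : Fin q)
    → let open Independent in
      count (λ a → kernel? (dropFirst I) a ×-dec (from (L I zero a) FinP.≟ y)) (allVecs q N)
      ≡ count (kernel? I) (allVecs q N)
  fibre-count {N} I y =
    ≡.trans (count-translate N _ p) (count-cong _ kernel? toKernel fromKernel (allVecs q N))
    where
    open Independent I
    open import Relation.Binary.Reasoning.Setoid setoid
    p = proj₁ (dual zero (to y))
    Lp≈y : L zero p ≈ to y
    Lp≈y = proj₁ (proj₂ (dual zero (to y)))
    Lp≈0 : ∀ k → L (suc k) p ≈ 0#
    Lp≈0 k = proj₂ (proj₂ (dual zero (to y))) (suc k) (λ ())
    toKernel : ∀ a → Independent.Kernel (dropFirst I) (a ⊕ p) × from (L zero (a ⊕ p)) ≡ y → Kernel a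
    toKernel a (ker , first) zero = +-identityˡ-unique (L zero a) (to y) (begin
      L zero a + to y       ≈⟨ +-congˡ Lp≈y ⟨
      L zero a + L zero p   ≈⟨ additive zero a p ⟨
      L zero (a ⊕ p)        ≈⟨ strictlyInverseˡ _ ⟨
      to (from (L zero (a ⊕ p))) ≡⟨ ≡.cong to first ⟩
      to y                  ∎)
    toKernel a (ker , first) (suc k) = begin
      L (suc k) a                  ≈⟨ +-identityʳ _ ⟨
      L (suc k) a + 0#             ≈⟨ +-congˡ (Lp≈0 k) ⟨
      L (suc k) a + L (suc k) p    ≈⟨ additive (suc k) a p ⟨
      L (suc k) (a ⊕ p)            ≈⟨ ker k ⟩
      0#                           ∎
    fromKernel : ∀ a → Kernel a → Independent.Kernel (dropFirst I) (a ⊕ p) × from (L zero (a ⊕ p)) ≡ y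
    fromKernel a ker = (λ k → begin
        L (suc k) (a ⊕ p)          ≈⟨ additive (suc k) a p ⟩
        L (suc k) a + L (suc k) p  ≈⟨ +-cong (ker (suc k)) (Lp≈0 k) ⟩
        0# + 0#                    ≈⟨ +-identityʳ _ ⟩
        0#                         ∎)
      , ≡.trans (from-cong (begin
        L zero (a ⊕ p)             ≈⟨ additive zero a p ⟩
        L zero a + L zero p        ≈⟨ +-cong (ker zero) Lp≈y ⟩
        0# + to y                  ≈⟨ +-identityˡ _ ⟩
        to y                       ∎)) (strictlyInverseʳ y)

  -- The common kernel of M independent functionals on (Fin q)^N has
  -- q^(N-M) elements, stated without subtraction as |ker| · q^M = q^N.
  kernel-count : ∀ {N M} (I : Independent N M) {r} {C : Pred (Vec (Fin q) N) r} (C? : Decidable C)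
    → (∀ a → C a → Independent.Kernel I a) → (∀ a → Independent.Kernel I a → C a)
    → count C? (allVecs q N) ℕ.* q ℕ.^ M ≡ q ℕ.^ N
  kernel-count {N} {zero} I C? _ fromKernel =
    ≡.trans (ℕP.*-identityʳ _) (count-allVecs-all N C? (λ a → fromKernel a (λ ())))
  kernel-count {N} {suc M} I C? toKernel fromKernel = begin
    count C? vecs ℕ.* (q ℕ.* q ℕ.^ M)          ≡⟨ ℕP.*-assoc (count C? vecs) q _ ⟨
    count C? vecs ℕ.* q ℕ.* q ℕ.^ M            ≡⟨ ≡.cong (ℕ._* q ℕ.^ M) (ℕP.*-comm (count C? vecs) q) ⟩
    q ℕ.* count C? vecs ℕ.* q ℕ.^ M            ≡⟨ ≡.cong (ℕ._* q ℕ.^ M) fibres ⟩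
    count (kernel? I') vecs ℕ.* q ℕ.^ M        ≡⟨ kernel-count I' (kernel? I') (λ _ k → k) (λ _ k → k) ⟩
    q ℕ.^ N                                    ∎
    where
    open ≡.≡-Reasoning
    open Independent
    I' = dropFirst I
    vecs = allVecs q N
    -- the kernel of the remaining functionals splits into q fibres of the
    -- first one, each of the size of the full kernel
    fibres : q ℕ.* count C? vecs ≡ count (kernel? I') vecs
    fibres = ≡.sym (begin
      count (kernel? I') vecs                        ≡⟨ count-partition (λ a → from (L I zero a)) (kernel? I') vecs ⟩
      sum (λ y → count (λ a → kernel? I' a ×-dec (from (L I zero a) FinP.≟ y)) vecs)
                                                     ≡⟨ sum-cong-≗ {q} (fibre-count I) ⟩
      sum {q} (λ _ → count (kernel? I) vecs)         ≡⟨ sum-const q _ ⟩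
      q ℕ.* count (kernel? I) vecs                   ≡⟨ ≡.cong (q ℕ.*_) (count-cong (kernel? I) C? fromKernel toKernel vecs) ⟩
      q ℕ.* count C? vecs                            ∎)

degree : ∀ {n} → Vec ℕ n → ℕ
degree = Vec.sum

degree-updateAt-suc : ∀ {n} (k : Fin n) (a : Vec ℕ n) → degree (updateAt a k suc) ≡ suc (degree a)
degree-updateAt-suc zero    (e ∷ a) = ≡.refl
degree-updateAt-suc (suc k) (e ∷ a) = ≡.trans (≡.cong (e ℕ.+_) (degree-updateAt-suc k a)) (ℕP.+-suc e (degree a))

degree-zeros : ∀ n → degree (replicate n 0) ≡ 0
degree-zeros zero    = ≡.refl
degree-zeros (suc n) = degree-zeros n

module Polynomials {c ℓ : Level} {q : ℕ} (F : FiniteField c ℓ q) where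
  open FiniteField F using (cring; _≟_; inverse)
  open CommutativeRing cring hiding (zero)
  open import Algebra.Properties.Ring ring using (+-inverseˡ-unique; -‿involutive)
  open import Algebra.Properties.CommutativeSemigroup *-commutativeSemigroup using (x∙yz≈y∙xz)
  open import Relation.Binary.Reasoning.Setoid setoid

  monoVal-updateAt-suc : ∀ {n} k (a : Vec ℕ n) x → monoVal F (updateAt a k suc) x ≈ x k * monoVal F a x
  monoVal-updateAt-suc zero    (e ∷ a) x = *-assoc _ _ _
  monoVal-updateAt-suc (suc k) (e ∷ a) x = begin
    pow F (x zero) e * monoVal F (updateAt a k suc) (x ∘ suc) ≈⟨ *-congˡ (monoVal-updateAt-suc k a (x ∘ suc)) ⟩
    pow F (x zero) e * (x (suc k) * monoVal F a (x ∘ suc))    ≈⟨ x∙yz≈y∙xz _ _ _ ⟩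
    x (suc k) * (pow F (x zero) e * monoVal F a (x ∘ suc))    ∎

  monoVal-zeros : ∀ n x → monoVal F (replicate n 0) x ≈ 1#
  monoVal-zeros zero    x = refl
  monoVal-zeros (suc n) x = trans (*-identityˡ _) (monoVal-zeros n (x ∘ suc))

  Poly : ℕ → Set c
  Poly n = List (Carrier × Vec ℕ n)

  evalP : ∀ {n} → Poly n → (Fin n → Carrier) → Carrier
  evalP []            x = 0#
  evalP ((c , a) ∷ g) x = c * monoVal F a x + evalP g x

  HasDegree≤ : ∀ {n} → ℕ → Poly n → Set c
  HasDegree≤ e g = All (λ t → degree (proj₂ t) ≤ e) g

  degree-weaken : ∀ {n e e'} {g : Poly n} → HasDegree≤ e g → e ≤ e' → HasDegree≤ e' g
  degree-weaken deg e≤e' = All.map (λ a≤e → ℕP.≤-trans a≤e e≤e') deg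

  evalP-++ : ∀ {n} (g h : Poly n) x → evalP (g ++ h) x ≈ evalP g x + evalP h x
  evalP-++ []            h x = sym (+-identityˡ _)
  evalP-++ ((c , a) ∷ g) h x = trans (+-congˡ (evalP-++ g h x)) (sym (+-assoc _ _ _))

  scale : ∀ {n} → Carrier → Poly n → Poly n
  scale β = map (λ (c , a) → β * c , a)

  evalP-scale : ∀ {n} β (g : Poly n) x → evalP (scale β g) x ≈ β * evalP g x
  evalP-scale β []            x = sym (zeroʳ β)
  evalP-scale β ((c , a) ∷ g) x = begin
    β * c * monoVal F a x + evalP (scale β g) x ≈⟨ +-cong (*-assoc _ _ _) (evalP-scale β g x) ⟩
    β * (c * monoVal F a x) + β * evalP g x     ≈⟨ distribˡ _ _ _ ⟨
    β * (c * monoVal F a x + evalP g x)         ∎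

  scaleShift : ∀ {n} → Carrier → Fin n → Poly n → Poly n
  scaleShift β k = map (λ (c , a) → β * c , updateAt a k suc)

  evalP-scaleShift : ∀ {n} β k (g : Poly n) x → evalP (scaleShift β k g) x ≈ (β * x k) * evalP g x
  evalP-scaleShift β k []            x = sym (zeroʳ _)
  evalP-scaleShift β k ((c , a) ∷ g) x = begin
    β * c * monoVal F (updateAt a k suc) x + evalP (scaleShift β k g) x
      ≈⟨ +-cong (*-congˡ (monoVal-updateAt-suc k a x)) (evalP-scaleShift β k g x) ⟩
    β * c * (x k * monoVal F a x) + (β * x k) * evalP g x
      ≈⟨ +-congʳ (trans (*-assoc _ _ _) (trans (*-congˡ (x∙yz≈y∙xz _ _ _)) (sym (*-assoc _ _ _)))) ⟩
    (β * x k) * (c * monoVal F a x) + (β * x k) * evalP g x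
      ≈⟨ distribˡ _ _ _ ⟨
    (β * x k) * (c * monoVal F a x + evalP g x) ∎

  Linear : ℕ → Set c
  Linear n = Carrier × Fin n × Carrier

  evalLinear : ∀ {n} → Linear n → (Fin n → Carrier) → Carrier
  evalLinear (α , k , w) x = α * (x k - w)

  mulLinear : ∀ {n} → Linear n → Poly n → Poly n
  mulLinear (α , k , w) g = scaleShift α k g ++ scale (α * - w) g

  evalP-mulLinear : ∀ {n} f (g : Poly n) x → evalP (mulLinear f g) x ≈ evalLinear f x * evalP g x
  evalP-mulLinear (α , k , w) g x = begin
    evalP (scaleShift α k g ++ scale (α * - w) g) x       ≈⟨ evalP-++ (scaleShift α k g) _ x ⟩
    evalP (scaleShift α k g) x + evalP (scale (α * - w) g) x
      ≈⟨ +-cong (evalP-scaleShift α k g x) (evalP-scale _ g x) ⟩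
    (α * x k) * evalP g x + (α * - w) * evalP g x         ≈⟨ distribʳ _ _ _ ⟨
    (α * x k + α * - w) * evalP g x                       ≈⟨ *-congʳ (distribˡ _ _ _) ⟨
    (α * (x k - w)) * evalP g x                           ∎

  degree-mulLinear : ∀ {n e} f (g : Poly n) → HasDegree≤ e g → HasDegree≤ (suc e) (mulLinear f g)
  degree-mulLinear {e = e} (α , k , w) g deg = AllP.++⁺
    (AllP.map⁺ (All.map (λ {(_ , a)} a≤e → ≡.subst (_≤ suc e) (≡.sym (degree-updateAt-suc k a)) (s≤s a≤e)) deg))
    (AllP.map⁺ (All.map ℕP.m≤n⇒m≤1+n deg))

  product : ∀ {n} → List (Linear n) → Poly n
  product {n} []       = (1# , replicate n 0) ∷ []
  product     (f ∷ fs) = mulLinear f (product fs)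

  degree-product : ∀ {n} (fs : List (Linear n)) → HasDegree≤ (length fs) (product fs)
  degree-product {n} []       = ≡.subst (_≤ 0) (≡.sym (degree-zeros n)) z≤n ∷ []
  degree-product     (f ∷ fs) = degree-mulLinear f (product fs) (degree-product fs)

  product-one : ∀ {n} (fs : List (Linear n)) x → All (λ f → evalLinear f x ≈ 1#) fs → evalP (product fs) x ≈ 1#
  product-one {n} []       x []         = trans (+-identityʳ _) (trans (*-identityˡ _) (monoVal-zeros n x))
  product-one     (f ∷ fs) x (f≈1 ∷ rest) = begin
    evalP (mulLinear f (product fs)) x      ≈⟨ evalP-mulLinear f (product fs) x ⟩
    evalLinear f x * evalP (product fs) x   ≈⟨ *-cong f≈1 (product-one fs x rest) ⟩
    1# * 1#                                 ≈⟨ *-identityˡ 1# ⟩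
    1#                                      ∎

  product-zero : ∀ {n} (fs : List (Linear n)) x → Any (λ f → evalLinear f x ≈ 0#) fs → evalP (product fs) x ≈ 0#
  product-zero (f ∷ fs) x (here f≈0) = begin
    evalP (mulLinear f (product fs)) x      ≈⟨ evalP-mulLinear f (product fs) x ⟩
    evalLinear f x * evalP (product fs) x   ≈⟨ *-congʳ f≈0 ⟩
    0# * evalP (product fs) x               ≈⟨ zeroˡ _ ⟩
    0#                                      ∎
  product-zero (f ∷ fs) x (there some) = begin
    evalP (mulLinear f (product fs)) x      ≈⟨ evalP-mulLinear f (product fs) x ⟩
    evalLinear f x * evalP (product fs) x   ≈⟨ *-congˡ (product-zero fs x some) ⟩
    evalLinear f x * 0#                     ≈⟨ zeroʳ _ ⟩
    0#                                      ∎

  -- Two distinct points u ≠ v of F^n are separated by a linear form which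
  -- is 1 at u and 0 at v: pick a coordinate k where they differ and take
  -- (u_k − v_k)⁻¹ (X_k − v_k).
  separator : ∀ {n} (u v : Fin n → Carrier) → ¬ (∀ k → u k ≈ v k)
    → Σ[ f ∈ Linear n ] (evalLinear f u ≈ 1# × evalLinear f v ≈ 0#)
  separator {n} u v u≉v = (α , k , v k) , at-u , at-v
    where
    differs = FinP.¬∀⟶∃¬ n (λ k → u k ≈ v k) (λ k → u k ≟ v k) u≉v
    k = proj₁ differs
    nonzero : ¬ (u k - v k ≈ 0#)
    nonzero diff≈0 = proj₂ differs (trans (+-inverseˡ-unique (u k) (- v k) diff≈0) (-‿involutive (v k)))
    α = proj₁ (inverse (u k - v k) nonzero)
    at-u : α * (u k - v k) ≈ 1#
    at-u = trans (*-comm _ _) (proj₂ (inverse (u k - v k) nonzero))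
    at-v : α * (v k - v k) ≈ 0#
    at-v = trans (*-congˡ (-‿inverseʳ (v k))) (zeroʳ α)

  -- Lagrange-type basis polynomials for m distinct points W₀,…,W_{m-1} of
  -- F^n: the product of separators of W i from every other W j is a
  -- polynomial of degree at most m that is 1 at W i and 0 at each W j, j ≠ i.
  module Lagrange {m n : ℕ} (W : Fin m → Fin n → Carrier) (distinct : Distinct F W) (i : Fin m) where

    separatorFrom : ∀ {j} → j ≢ i → Σ[ f ∈ Linear n ] (evalLinear f (W i) ≈ 1# × evalLinear f (W j) ≈ 0#)
    separatorFrom {j} j≢i = separator (W i) (W j) (distinct i j (j≢i ∘ ≡.sym))

    separators : List (Fin m) → List (Linear n)
    separators []       = []
    separators (j ∷ js) with j FinP.≟ i
    ... | yes _   = separators js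
    ... | no  j≢i = proj₁ (separatorFrom j≢i) ∷ separators js

    separators-length : ∀ js → length (separators js) ≤ length js
    separators-length []       = z≤n
    separators-length (j ∷ js) with j FinP.≟ i
    ... | yes _ = ℕP.m≤n⇒m≤1+n (separators-length js)
    ... | no  _ = s≤s (separators-length js)

    separators-at-i : ∀ js → All (λ f → evalLinear f (W i) ≈ 1#) (separators js)
    separators-at-i []       = []
    separators-at-i (j ∷ js) with j FinP.≟ i
    ... | yes _   = separators-at-i js
    ... | no  j≢i = proj₁ (proj₂ (separatorFrom j≢i)) ∷ separators-at-i js

    separators-at-j : ∀ js {j} → j ∈ js → j ≢ i → Any (λ f → evalLinear f (W j) ≈ 0#) (separators js)
    separators-at-j (j' ∷ js) j∈ j≢i with j' FinP.≟ i
    separators-at-j (j' ∷ js) (here ≡.refl) j≢i | yes j≡i = ⊥-elim (j≢i j≡i)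
    separators-at-j (j' ∷ js) (there j∈)    j≢i | yes _   = separators-at-j js j∈ j≢i
    separators-at-j (j' ∷ js) (here ≡.refl) _   | no j'≢i = here (proj₂ (proj₂ (separatorFrom j'≢i)))
    separators-at-j (j' ∷ js) (there j∈)    j≢i | no _    = there (separators-at-j js j∈ j≢i)

    lagrange : Poly n
    lagrange = product (separators (allFin m))

    lagrange-degree : HasDegree≤ m lagrange
    lagrange-degree = degree-weaken (degree-product (separators (allFin m))) length≤m
      where
      length≤m : length (separators (allFin m)) ≤ m
      length≤m = ℕP.≤-trans (separators-length (allFin m)) (ℕP.≤-reflexive (ListP.length-tabulate (λ j → j)))

    lagrange-at-i : evalP lagrange (W i) ≈ 1#
    lagrange-at-i = product-one _ (W i) (separators-at-i (allFin m))

    lagrange-at-j : ∀ j → j ≢ i → evalP lagrange (W j) ≈ 0#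
    lagrange-at-j j j≢i = product-zero _ (W j) (separators-at-j (allFin m) (∈-allFin j) j≢i)

expVecs-complete : ∀ n d (a : Vec ℕ n) → degree a ≤ d → a ∈ expVecs n d
expVecs-complete zero    d []      _   = here ≡.refl
expVecs-complete (suc n) d (k ∷ a) a≤d =
  ∈-concatMap⁺ (λ k → map (k ∷_) (expVecs n (d ∸ k))) (lose (∈-upTo⁺ (s≤s (ℕP.m+n≤o⇒m≤o k a≤d)))
                         (∈-map⁺ (k ∷_) (expVecs-complete n (d ∸ k) a tail≤)))
  where
  tail≤ : degree a ≤ d ∸ k
  tail≤ = ℕP.m+n≤o⇒m≤o∸n (degree a) (ℕP.≤-trans (ℕP.≤-reflexive (ℕP.+-comm (degree a) k)) a≤d)

module Realization {c ℓ : Level} {q : ℕ} (F : FiniteField c ℓ q) where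
  open FiniteField F using (cring)
  open CommutativeRing cring hiding (zero)
  open import Algebra.Properties.CommutativeSemigroup *-commutativeSemigroup using (interchange)
  open Inverse (FiniteField.enum F) using (to; from; strictlyInverseˡ)
  open import Relation.Binary.Reasoning.Setoid setoid
  open VectorCounting F using (_⊕_)
  open Polynomials F

  evalPoly-⊕ : ∀ {s} (ms : List (Vec ℕ s × Vec ℕ s)) (x y : Vec (Fin q) (length ms)) u v
    → evalPoly F ms (x ⊕ y) u v ≈ evalPoly F ms x u v + evalPoly F ms y u v
  evalPoly-⊕ []             []       []       u v = sym (+-identityʳ _)
  evalPoly-⊕ ((a , b) ∷ ms) (x ∷ xs) (y ∷ ys) u v = begin
    to (from (to x + to y)) * m + evalPoly F ms (xs ⊕ ys) u v
      ≈⟨ +-cong (*-congʳ (strictlyInverseˡ _)) (evalPoly-⊕ ms xs ys u v) ⟩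
    (to x + to y) * m + (evalPoly F ms xs u v + evalPoly F ms ys u v)
      ≈⟨ +-congʳ (distribʳ _ _ _) ⟩
    (to x * m + to y * m) + (evalPoly F ms xs u v + evalPoly F ms ys u v)
      ≈⟨ interchange+ _ _ _ _ ⟩
    (to x * m + evalPoly F ms xs u v) + (to y * m + evalPoly F ms ys u v) ∎
    where
    m = monoVal F a u * monoVal F b v
    open import Algebra.Properties.CommutativeSemigroup +-commutativeSemigroup
      renaming (interchange to interchange+)

  zeroCoeffs : ∀ {s} (ms : List (Vec ℕ s × Vec ℕ s)) → Vec (Fin q) (length ms)
  zeroCoeffs ms = replicate (length ms) (from 0#)

  evalPoly-zero : ∀ {s} (ms : List (Vec ℕ s × Vec ℕ s)) u v → evalPoly F ms (zeroCoeffs ms) u v ≈ 0#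
  evalPoly-zero []             u v = refl
  evalPoly-zero ((a , b) ∷ ms) u v = begin
    to (from 0#) * (monoVal F a u * monoVal F b v) + evalPoly F ms (zeroCoeffs ms) u v
      ≈⟨ +-cong (*-congʳ (strictlyInverseˡ 0#)) (evalPoly-zero ms u v) ⟩
    0# * (monoVal F a u * monoVal F b v) + 0# ≈⟨ +-identityʳ _ ⟩
    0# * (monoVal F a u * monoVal F b v)      ≈⟨ zeroˡ _ ⟩
    0#                                        ∎

  singleCoeff : ∀ {s} {mono : Vec ℕ s × Vec ℕ s} (ms : List (Vec ℕ s × Vec ℕ s)) → mono ∈ ms
    → Carrier → Vec (Fin q) (length ms)
  singleCoeff (_ ∷ ms) (here ≡.refl) c = from c ∷ zeroCoeffs ms
  singleCoeff (_ ∷ ms) (there p)     c = from 0# ∷ singleCoeff ms p c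

  evalPoly-single : ∀ {s} {a b : Vec ℕ s} (ms : List (Vec ℕ s × Vec ℕ s)) (p : (a , b) ∈ ms) c u v
    → evalPoly F ms (singleCoeff ms p c) u v ≈ c * (monoVal F a u * monoVal F b v)
  evalPoly-single (_ ∷ ms) (here ≡.refl) c u v =
    trans (+-cong (*-congʳ (strictlyInverseˡ c)) (evalPoly-zero ms u v)) (+-identityʳ _)
  evalPoly-single (_ ∷ ms) (there p) c u v =
    trans (+-cong (*-congʳ (strictlyInverseˡ 0#)) (evalPoly-single ms p c u v)) (trans (+-congʳ (zeroˡ _)) (+-identityˡ _))

  BiPoly : ℕ → Set c
  BiPoly s = List (Carrier × Vec ℕ s × Vec ℕ s)

  evalB : ∀ {s} → BiPoly s → (Fin s → Carrier) → (Fin s → Carrier) → Carrier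
  evalB []                  u v = 0#
  evalB ((c , a , b) ∷ T) u v = c * (monoVal F a u * monoVal F b v) + evalB T u v

  HasBidegree≤ : ∀ {s} → ℕ → BiPoly s → Set c
  HasBidegree≤ d T = All (λ (_ , a , b) → degree a ≤ d × degree b ≤ d) T

  evalB-++ : ∀ {s} (T T' : BiPoly s) u v → evalB (T ++ T') u v ≈ evalB T u v + evalB T' u v
  evalB-++ []                T' u v = sym (+-identityˡ _)
  evalB-++ ((c , a , b) ∷ T) T' u v = trans (+-congˡ (evalB-++ T T' u v)) (sym (+-assoc _ _ _))

  realize : ∀ s d (T : BiPoly s) → HasBidegree≤ d T
    → Σ[ cs ∈ Coeffs F s d ] (∀ u v → evalPoly F (monomials s d) cs u v ≈ evalB T u v)
  realize s d []                []                   = zeroCoeffs (monomials s d) , evalPoly-zero (monomials s d)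
  realize s d ((c , a , b) ∷ T) ((a≤d , b≤d) ∷ degT) =
    singleCoeff (monomials s d) ab∈ c ⊕ proj₁ rest , λ u v →
      trans (evalPoly-⊕ (monomials s d) (singleCoeff (monomials s d) ab∈ c) (proj₁ rest) u v)
            (+-cong (evalPoly-single (monomials s d) ab∈ c u v) (proj₂ rest u v))
    where
    rest = realize s d T degT
    ab∈ = ∈-cartesianProduct⁺ (expVecs-complete s d a a≤d) (expVecs-complete s d b b≤d)

  tensor : ∀ {s} → Carrier → Poly s → Poly s → BiPoly s
  tensor t []            h = []
  tensor t ((c , a) ∷ g) h = map (λ (c' , b) → t * c * c' , a , b) h ++ tensor t g h

  evalB-tensor : ∀ {s} t (g h : Poly s) u v → evalB (tensor t g h) u v ≈ t * (evalP g u * evalP h v)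
  evalB-tensor t []            h u v = sym (trans (*-congˡ (zeroˡ _)) (zeroʳ _))
  evalB-tensor t ((c , a) ∷ g) h u v = begin
    evalB (map row h ++ tensor t g h) u v
      ≈⟨ evalB-++ (map row h) _ u v ⟩
    evalB (map row h) u v + evalB (tensor t g h) u v
      ≈⟨ +-cong (evalB-row h) (evalB-tensor t g h u v) ⟩
    t * ((c * monoVal F a u) * evalP h v) + t * (evalP g u * evalP h v)
      ≈⟨ distribˡ _ _ _ ⟨
    t * ((c * monoVal F a u) * evalP h v + evalP g u * evalP h v)
      ≈⟨ *-congˡ (distribʳ _ _ _) ⟨
    t * ((c * monoVal F a u + evalP g u) * evalP h v) ∎
    where
    row = λ ((c' , b) : Carrier × Vec ℕ _) → t * c * c' , a , b
    evalB-row : ∀ h → evalB (map row h) u v ≈ t * ((c * monoVal F a u) * evalP h v)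
    evalB-row []             = sym (trans (*-congˡ (zeroʳ _)) (zeroʳ _))
    evalB-row ((c' , b) ∷ h) = begin
      t * c * c' * (monoVal F a u * monoVal F b v) + evalB (map row h) u v
        ≈⟨ +-cong (trans (*-congʳ (*-assoc _ _ _)) (trans (*-assoc _ _ _) (*-congˡ (interchange _ _ _ _)))) (evalB-row h) ⟩
      t * ((c * monoVal F a u) * (c' * monoVal F b v)) + t * ((c * monoVal F a u) * evalP h v)
        ≈⟨ distribˡ _ _ _ ⟨
      t * ((c * monoVal F a u) * (c' * monoVal F b v) + (c * monoVal F a u) * evalP h v)
        ≈⟨ *-congˡ (distribˡ _ _ _) ⟨
      t * ((c * monoVal F a u) * (c' * monoVal F b v + evalP h v)) ∎

  bidegree-tensor : ∀ {s d} t (g h : Poly s) → HasDegree≤ d g → HasDegree≤ d h → HasBidegree≤ d (tensor t g h)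
  bidegree-tensor t []            h []            degh = []
  bidegree-tensor t ((c , a) ∷ g) h (a≤d ∷ degg) degh =
    AllP.++⁺ (AllP.map⁺ (All.map (a≤d ,_) degh)) (bidegree-tensor t g h degg degh)

module Evaluations {c ℓ : Level} {q : ℕ} (F : FiniteField c ℓ q) {s r : ℕ} (d : ℕ)
                   (U : Fin s → Fin s → FiniteField.Carrier F) (V : Fin r → Fin s → FiniteField.Carrier F) where
  open FiniteField F using (cring)
  open CommutativeRing cring hiding (zero)
  open VectorCounting F
  open Polynomials F
  open Realization F

  row : Fin (s ℕ.* r) → Fin s
  row k = proj₁ (remQuot {s} r k)

  column : Fin (s ℕ.* r) → Fin r
  column k = proj₂ (remQuot {s} r k)

  evalAt : Fin (s ℕ.* r) → Coeffs F s d → Carrier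
  evalAt k cs = evalPoly F (monomials s d) cs (U (row k)) (V (column k))

  vanishes⇒kernel : ∀ cs → VanishesOn F d U V cs → ∀ k → evalAt k cs ≈ 0#
  vanishes⇒kernel cs vanish k = vanish (row k) (column k)

  kernel⇒vanishes : ∀ cs → (∀ k → evalAt k cs ≈ 0#) → VanishesOn F d U V cs
  kernel⇒vanishes cs ker i j =
    ≡.subst (λ (i , j) → evalPoly F (monomials s d) cs (U i) (V j) ≈ 0#) (FinP.remQuot-combine {s} {r} i j) (ker (combine i j))

  -- If U and V consist of distinct points and s, r ≤ d, the evaluations
  -- are independent: t · δᵢ(X) · δⱼ(Y), with δ the Lagrange polynomials of
  -- U and V, lies in 𝒫 and takes the value t at (U i, V j) and 0 at every
  -- other point of U × V.
  independent : Distinct F U → Distinct F V → s ≤ d → r ≤ d → Independent (length (monomials s d)) (s ℕ.* r)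
  independent U-distinct V-distinct s≤d r≤d = record
    { L        = evalAt
    ; additive = λ k a b → evalPoly-⊕ (monomials s d) a b _ _
    ; dual     = dual
    }
    where
    module δU = Lagrange U U-distinct
    module δV = Lagrange V V-distinct

    dual : ∀ k t → Σ[ cs ∈ Coeffs F s d ] (evalAt k cs ≈ t × (∀ k' → k' ≢ k → evalAt k' cs ≈ 0#))
    dual k t = cs , at-k , elsewhere
      where
      i = row k
      j = column k
      realized = realize s d (tensor t (δU.lagrange i) (δV.lagrange j))
                   (bidegree-tensor t _ _ (degree-weaken (δU.lagrange-degree i) s≤d) (degree-weaken (δV.lagrange-degree j) r≤d))
      cs = proj₁ realized
      δ : Fin (s ℕ.* r) → Carrier
      δ k' = evalP (δU.lagrange i) (U (row k')) * evalP (δV.lagrange j) (V (column k'))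
      value : ∀ k' → evalAt k' cs ≈ t * δ k'
      value k' = trans (proj₂ realized _ _) (evalB-tensor t (δU.lagrange i) (δV.lagrange j) _ _)
      δ-at-k : δ k ≈ 1#
      δ-at-k = trans (*-cong (δU.lagrange-at-i i) (δV.lagrange-at-i j)) (*-identityˡ 1#)
      δ-elsewhere : ∀ k' → k' ≢ k → δ k' ≈ 0#
      δ-elsewhere k' k'≢k with row k' FinP.≟ i | column k' FinP.≟ j
      ... | no i'≢i | _ = trans (*-congʳ (δU.lagrange-at-j i (row k') i'≢i)) (zeroˡ _)
      ... | yes _   | no j'≢j = trans (*-congˡ (δV.lagrange-at-j j (column k') j'≢j)) (zeroʳ _)
      ... | yes i'≡i | yes j'≡j = ⊥-elim (k'≢k (begin
        k'                           ≡⟨ FinP.combine-remQuot {s} r k' ⟨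
        combine (row k') (column k') ≡⟨ ≡.cong₂ combine i'≡i j'≡j ⟩
        combine i j                  ≡⟨ FinP.combine-remQuot {s} r k ⟩
        k                            ∎))
        where open ≡.≡-Reasoning
      at-k : evalAt k cs ≈ t
      at-k = trans (value k) (trans (*-congˡ δ-at-k) (*-identityʳ t))
      elsewhere : ∀ k' → k' ≢ k → evalAt k' cs ≈ 0#
      elsewhere k' k'≢k = trans (value k') (trans (*-congˡ (δ-elsewhere k' k'≢k)) (zeroʳ t))

-- ℕ's arithmetic is opened unqualified only here: inside the field modules
-- these names would clash with the ring operations.
open import Data.Nat using (_*_; _+_; _^_)

lemma4 : {c ℓ : Level} (q s r : ℕ) → IsPrimePower q → (F : FiniteField c ℓ q)
    → 4 ≤ s → 1 ≤ r
    → r * r ≤ q → r ≤ s * s ∸ s + 2 → s * s ≤ q → s ≤ s * s ∸ s + 2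
    → (U : Fin s → Fin s → FiniteField.Carrier F) → Distinct F U
    → (V : Fin r → Fin s → FiniteField.Carrier F) → Distinct F V
    → countVanishing F (s * s ∸ s + 2) U V * q ^ (s * r)
    ≡ q ^ length (monomials s (s * s ∸ s + 2))
lemma4 q s r _ F _ _ _ r≤d _ s≤d U U-distinct V V-distinct =
  kernel-count (independent U-distinct V-distinct s≤d r≤d) (vanishes? F d U V) vanishes⇒kernel kernel⇒vanishes
  where
  d = s * s ∸ s + 2
  open VectorCounting F using (kernel-count)
  open Evaluations F d U V
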